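{- Let $\tau=(\tau_1,\dots,\tau_\ell)\in\mathbb{Z}_{>0}^\ell$, $0\le k\le\ell$, and let $\hat P_\tau=C\sqcup O$ be the $k$-decomposition. Let $b\in C\setminus\{\hat0\}$, say $b\in Y^i$ (so $1\le i\le k$), and let $F=\mathcal{O}_{C,O}(\tau)\cap\{x_b=0\}$. Then $F\cong\mathcal{O}_{\tilde C,O}(\tilde\tau)$ (affinely isomorphic via the coordinate projection forgetting the coordinate $x_b$), where $$\tilde\tau=(\tau_1,\dots,\tau_{i-1},\tau_i-1,\tau_{i+1},\dots,\tau_\ell)$$ with a zero entry omitted, $\tilde C=C\setminus\{b\}$, and $\hat P_{\tilde\tau}$ is identified with $\hat P_\tau\setminus\{b\}$.
   Context: For $\tau=(\tau_1,\dots,\tau_\ell)$ a tuple of positive integers, $P_\tau$ is the poset with ranks $Y^1,\dots,Y^\ell$, $|Y^i|=\tau_i$, and $y<z$ for $y\in Y^i,z\in Y^j$ iff $i<j$; $\hat P_\tau$ adds a minimum $\hat0$ and maximum $\hat1$, with $Y^0=\{\hat0\}$, $Y^{\ell+1}=\{\hat1\}$; covering relations are the pairs $p\in Y^i$, $q\in Y^{i+1}$. The $k$-decomposition is $C=\bigcup_{i=0}^kY^i$, $O=\bigcup_{i=k+1}^{\ell+1}Y^i$. For a finite poset $\hat P$ with minimum $\hat0$, maximum $\hat1$ and partition $\hat P=C\sqcup O$ with $\hat0\in C$, $\hat1\in O$, the chain-order polytope $\mathcal{O}_{C,O}(\hat P)\subseteq\mathbb{R}^{\hat P}$ is defined by: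 $x_{\hat0}=0$, $x_{\hat1}=1$; $x_p\le x_q$ for covering relations $p\prec q$ with $p,q\in O$; $0\le x_p$ for $p\in C$; and $x_{p_1}+\dots+x_{p_r}\le x_a$ for every chain of covering relations $p_1\prec\dots\prec p_r\prec a$ with $p_i\in C$, $a\in O$, $r\ge0$. $\mathcal{O}_{C,O}(\tau)$ denotes this for $\hat P_\tau$.
   Formalization: The polytopes $\mathcal{O}_{C,O}(\tau)$, F and $\mathcal{O}_{\tilde C,O}(\tilde\tau)$ are taken as sets of points with rational coordinates rather than real ones. -}

module Defs where

open import Data.Nat using (ℕ; zero; suc; _≤ᵇ_)
open import Data.Fin using (Fin; zero; suc; toℕ; punchIn)
open import Data.List using (List; []; _∷_; length; lookup; map; foldr)
open import Data.List.Relation.Unary.All using (All)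
open import Data.Bool using (Bool; true; false)
open import Data.Product using (Σ; _×_; _,_)
open import Data.Unit using (⊤)
open import Data.Rational using (ℚ; 0ℚ; 1ℚ; _+_; _≤_)
open import Relation.Binary.PropositionalEquality using (_≡_)

-- Generic chain-order polytope O_{C,O}(P̂) (points with rational coords).
-- E : elements of P̂, _≺_ : covering relation, isC p ≡ true  iff p ∈ C,
-- isC p ≡ false iff p ∈ O.

sumℚ : List ℚ → ℚ
sumℚ = foldr _+_ 0ℚ

Linked : {E : Set} → (E → E → Set) → List E → E → Set
Linked _≺_ [] a = ⊤
Linked _≺_ (p ∷ []) a = p ≺ a
Linked _≺_ (p ∷ q ∷ ps) a = (p ≺ q) × Linked _≺_ (q ∷ ps) a

record InChainOrderPolytope {E : Set} (_≺_ : E → E → Set) (isC : E → Bool)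
                            (bot top : E) (x : E → ℚ) : Set where
  field
    bot≡0   : x bot ≡ 0ℚ
    top≡1   : x top ≡ 1ℚ
    orderO  : ∀ p q → p ≺ q → isC p ≡ false → isC q ≡ false → x p ≤ x q
    nonnegC : ∀ p → isC p ≡ true → 0ℚ ≤ x p
    chainC  : ∀ (ps : List E) (a : E) → All (λ p → isC p ≡ true) ps →
              isC a ≡ false → Linked _≺_ ps a → sumℚ (map x ps) ≤ x a

-- The poset P̂_τ : ranks Y⁰ = {0̂}, Yⁱ (|Yⁱ| = τᵢ), Y^{ℓ+1} = {1̂}.
-- mid i j  is the j-th element of rank (toℕ i + 1).

data Elem (τ : List ℕ) : Set where
  bot : Elem τ
  mid : (i : Fin (length τ)) → Fin (lookup τ i) → Elem τ
  top : Elem τ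

rank : {τ : List ℕ} → Elem τ → ℕ
rank bot = 0
rank (mid i j) = suc (toℕ i)
rank {τ} top = suc (length τ)

_⋖_ : {τ : List ℕ} → Elem τ → Elem τ → Set
p ⋖ q = suc (rank p) ≡ rank q

isCₖ : {τ : List ℕ} → ℕ → Elem τ → Bool
isCₖ k p = rank p ≤ᵇ k

InOτ : (τ : List ℕ) (k : ℕ) → (Elem τ → ℚ) → Set
InOτ τ k = InChainOrderPolytope (_⋖_ {τ}) (isCₖ k) bot top

decr : ℕ → List ℕ → List ℕ
decr zero ts = zero ∷ ts            -- unused (τ is positive)
decr (suc zero) ts = ts
decr (suc (suc m)) ts = suc m ∷ ts

shrink : (τ : List ℕ) → Fin (length τ) → List ℕ
shrink (t ∷ ts) zero = decr t ts
shrink (t ∷ ts) (suc i) = t ∷ shrink ts i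

-- identification of the middle ranks of P̂_τ̃ with those of P̂_τ minus
-- b = mid i j (ranks kept in order; inside rank i, skip the index j)
midMap : (τ : List ℕ) (i : Fin (length τ)) (j : Fin (lookup τ i)) →
         (i' : Fin (length (shrink τ i))) → Fin (lookup (shrink τ i) i') →
         Σ (Fin (length τ)) (λ a → Fin (lookup τ a))
midMap (suc zero ∷ ts) zero j i' j' = suc i' , j'
midMap (suc (suc m) ∷ ts) zero j zero j' = zero , punchIn j j'
midMap (suc (suc m) ∷ ts) zero j (suc i') j' = suc i' , j'
midMap (t ∷ ts) (suc i) j zero j' = zero , j'
midMap (t ∷ ts) (suc i) j (suc i') j' with midMap ts i j i' j'
... | a , c = suc a , c

ι : (τ : List ℕ) (i : Fin (length τ)) (j : Fin (lookup τ i)) →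
    Elem (shrink τ i) → Elem τ
ι τ i j bot = bot
ι τ i j top = top
ι τ i j (mid i' j') with midMap τ i j i' j'
... | a , c = mid a c

-- On the face F we have x_b = 0, so b contributes nothing to any chain sum.  A covering chain
-- of P̂_τ̃ becomes one of P̂_τ after inserting b wherever it jumps over a deleted rank (τᵢ = 1);
-- hence the projection of a point of F satisfies the inequalities of O_{C̃,O}(τ̃).  Conversely,
-- extend y ∈ O_{C̃,O}(τ̃) by x_b = 0: a chain of P̂_τ passing through b either closes up once b
-- is removed (τᵢ = 1) or is rerouted through another element of Yⁱ, which lies in C̃ and has a
-- nonnegative coordinate, so its chain sum can only grow.
module Submission where

open import Defs
open import Data.Nat using (ℕ; zero; suc; _≤_; _<_; _≤ᵇ_)
open import Data.Nat.Properties using (≤ᵇ⇒≤; ≤⇒≤ᵇ; ≤-trans; n≤1+n; suc-injective)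
open import Data.Fin as Fin using (Fin; zero; suc; toℕ; punchIn; punchOut)
open import Data.Fin.Properties
  using (punchInᵢ≢i; punchOut-punchIn; punchIn-punchOut; punchOut-cong)
open import Data.List using (List; []; _∷_; length; lookup; map)
open import Data.List.Properties using (map-cong)
open import Data.List.Relation.Unary.All using (All; []; _∷_)
open import Data.Bool using (Bool; true; false)
open import Data.Bool.Properties using (T-≡)
open import Data.Maybe as Maybe using (Maybe; just; nothing)
open import Data.Maybe.Properties using (just-injective)
open import Data.Empty using (⊥; ⊥-elim)
open import Data.Unit using (tt)
open import Data.Product as Product using (Σ; _×_; _,_; proj₁; ∃-syntax)
open import Data.Sum as Sum using (_⊎_; inj₁; inj₂; [_,_]′)
open import Data.Rational as ℚ using (ℚ; 0ℚ)
import Data.Rational.Properties as ℚP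
open import Function using (_∘_; id; const)
open import Function.Bundles using (Equivalence)
open import Function.Definitions using (Injective)
open import Relation.Nullary using (yes; no; contradiction)
open import Relation.Binary.PropositionalEquality
  using (_≡_; _≢_; _≗_; refl; sym; trans; cong; subst; module ≡-Reasoning)

record IsDeletion {A B : Set} (_≺A_ : A → A → Set) (_≺B_ : B → B → Set)
                  (isC : B → Bool) (f : A → B) (b : B) : Set where
  field
    injective  : Injective _≡_ _≡_ f
    f≢b        : ∀ e → f e ≢ b
    split      : ∀ p → p ≡ b ⊎ ∃[ e ] (p ≡ f e)
    b∈C        : isC b ≡ true
    C-downward : ∀ {p q} → p ≺B q → isC q ≡ true → isC p ≡ true
    cover      : ∀ {h q} → h ≺A q → f h ≺B f q ⊎ (f h ≺B b × b ≺B f q)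
    reflect    : ∀ {h q} → f h ≺B f q → h ≺A q
    bypass     : ∀ {h q} → f h ≺B b → b ≺B f q →
                 h ≺A q ⊎ ∃[ b′ ] (isC (f b′) ≡ true × h ≺A b′ × b′ ≺A q)

Linked-tail : ∀ {E : Set} {_≺_ : E → E → Set} {p} ps {a} →
              Linked _≺_ (p ∷ ps) a → Linked _≺_ ps a
Linked-tail []      _       = tt
Linked-tail (_ ∷ _) (_ , L) = L

module Deletion {A B : Set} {_≺A_ : A → A → Set} {_≺B_ : B → B → Set}
                {isC : B → Bool} {f : A → B} {b : B}
                (deletion : IsDeletion _≺A_ _≺B_ isC f b)
                {botA topA : A} {botB topB : B}
                (f-bot : f botA ≡ botB) (f-top : f topA ≡ topB) where

  open IsDeletion deletion
  open InChainOrderPolytope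

  Face : (B → ℚ) → Set
  Face x = InChainOrderPolytope _≺B_ isC botB topB x × x b ≡ 0ℚ

  Polytopeₐ : (A → ℚ) → Set
  Polytopeₐ = InChainOrderPolytope _≺A_ (isC ∘ f) botA topA

  data Detour (Q : A → Set) : List A → List B → Set where
    []      : Detour Q [] []
    _∷_     : ∀ e {es ps} → Detour Q es ps → Detour Q (e ∷ es) (f e ∷ ps)
    insert  : ∀ {es ps} → Detour Q es ps → Detour Q es (b ∷ ps)
    replace : ∀ {e es ps} → Q e → Detour Q es ps → Detour Q (e ∷ es) (b ∷ ps)

  Insertion : List A → List B → Set
  Insertion = Detour (λ _ → ⊥)

  liftChainFrom : ∀ h es a → Linked _≺A_ (h ∷ es) a →
                  Σ (List B) (λ ps → Insertion es ps × Linked _≺B_ (f h ∷ ps) (f a))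
  liftChainFrom h [] a h≺a with cover h≺a
  ... | inj₁ fh≺fa         = [] , [] , fh≺fa
  ... | inj₂ (fh≺b , b≺fa) = b ∷ [] , insert [] , fh≺b , b≺fa
  liftChainFrom h (q ∷ es) a (h≺q , L) with liftChainFrom q es a L | cover h≺q
  ... | ps , D , L′ | inj₁ fh≺fq         = f q ∷ ps , q ∷ D , fh≺fq , L′
  ... | ps , D , L′ | inj₂ (fh≺b , b≺fq) = b ∷ f q ∷ ps , insert (q ∷ D) , fh≺b , b≺fq , L′

  liftChain : ∀ es a → Linked _≺A_ es a →
              Σ (List B) (λ ps → Insertion es ps × Linked _≺B_ ps (f a))
  liftChain []       a _ = [] , [] , tt
  liftChain (h ∷ es) a L =
    let ps , D , L′ = liftChainFrom h es a L in f h ∷ ps , h ∷ D , L′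

  Cₐ : A → Set
  Cₐ e = isC (f e) ≡ true

  mutual
    lowerChainFrom : ∀ h ps a → Linked _≺B_ (f h ∷ ps) (f a) →
                     Σ (List A) (λ es → Detour Cₐ es ps × Linked _≺A_ (h ∷ es) a)
    lowerChainFrom h []       a fh≺fa = [] , [] , reflect fh≺fa
    lowerChainFrom h (p ∷ ps) a (fh≺p , L) with split p
    ... | inj₁ refl       = lowerChainVia h ps a fh≺p L
    ... | inj₂ (q , refl) =
      let es , D , L′ = lowerChainFrom q ps a L in q ∷ es , q ∷ D , reflect fh≺p , L′

    lowerChainVia : ∀ h ps a → f h ≺B b → Linked _≺B_ (b ∷ ps) (f a) →
                    Σ (List A) (λ es → Detour Cₐ es (b ∷ ps) × Linked _≺A_ (h ∷ es) a)
    lowerChainVia h [] a fh≺b b≺fa with bypass fh≺b b≺fa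
    ... | inj₁ h≺a                       = [] , insert [] , h≺a
    ... | inj₂ (b′ , b′∈C , h≺b′ , b′≺a) = b′ ∷ [] , replace b′∈C [] , h≺b′ , b′≺a
    lowerChainVia h (p ∷ ps) a fh≺b (b≺p , L) with split p
    ... | inj₁ refl =
      let es , D , L′ = lowerChainVia h ps a fh≺b L in es , insert D , L′
    ... | inj₂ (q , refl) with lowerChainFrom q ps a L | bypass fh≺b b≺p
    ...   | es , D , L′ | inj₁ h≺q = q ∷ es , insert (q ∷ D) , h≺q , L′
    ...   | es , D , L′ | inj₂ (b′ , b′∈C , h≺b′ , b′≺q) =
      b′ ∷ q ∷ es , replace b′∈C (q ∷ D) , h≺b′ , b′≺q , L′

  lowerChain : ∀ ps a → Linked _≺B_ ps (f a) →
               Σ (List A) (λ es → Detour Cₐ es ps × Linked _≺A_ es a)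
  lowerChain []       a _ = [] , [] , tt
  lowerChain (p ∷ ps) a L with split p
  ... | inj₁ refl =
    let es , D , L′ = lowerChain ps a (Linked-tail ps L) in es , insert D , L′
  ... | inj₂ (h , refl) =
    let es , D , L′ = lowerChainFrom h ps a L in h ∷ es , h ∷ D , L′

  All-Detour : ∀ {Q} {P : B → Set} → P b → ∀ {es ps} → Detour Q es ps →
               All (P ∘ f) es → All P ps
  All-Detour Pb []            []         = []
  All-Detour Pb (e ∷ D)       (Pe ∷ Pes) = Pe ∷ All-Detour Pb D Pes
  All-Detour Pb (insert D)    Pes        = Pb ∷ All-Detour Pb D Pes
  All-Detour Pb (replace _ D) (_ ∷ Pes)  = Pb ∷ All-Detour Pb D Pes

  All-Detour⁻ : ∀ {Q} {P : B → Set} → (∀ {e} → Q e → P (f e)) → ∀ {es ps} →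
                Detour Q es ps → All P ps → All (P ∘ f) es
  All-Detour⁻ Q⇒P []             []         = []
  All-Detour⁻ Q⇒P (e ∷ D)        (Pe ∷ Pps) = Pe ∷ All-Detour⁻ Q⇒P D Pps
  All-Detour⁻ Q⇒P (insert D)     (_ ∷ Pps)  = All-Detour⁻ Q⇒P D Pps
  All-Detour⁻ Q⇒P (replace Qe D) (_ ∷ Pps)  = Q⇒P Qe ∷ All-Detour⁻ Q⇒P D Pps

  module _ (x : B → ℚ) (x-b : x b ≡ 0ℚ) where

    b-invisible : ∀ s → x b ℚ.+ s ≡ s
    b-invisible s = trans (cong (ℚ._+ s) x-b) (ℚP.+-identityˡ s)

    sum-Insertion : ∀ {es ps} → Insertion es ps → sumℚ (map x ps) ≡ sumℚ (map (x ∘ f) es)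
    sum-Insertion []            = refl
    sum-Insertion (e ∷ D)       = cong (x (f e) ℚ.+_) (sum-Insertion D)
    sum-Insertion (insert D)    = trans (b-invisible _) (sum-Insertion D)
    sum-Insertion (replace () _)

    sum-Detour-≤ : ∀ {Q} → (∀ {e} → Q e → 0ℚ ℚ.≤ x (f e)) → ∀ {es ps} →
                   Detour Q es ps → sumℚ (map x ps) ℚ.≤ sumℚ (map (x ∘ f) es)
    sum-Detour-≤ Q⇒0≤ []             = ℚP.≤-refl
    sum-Detour-≤ Q⇒0≤ (e ∷ D)        = ℚP.+-monoʳ-≤ (x (f e)) (sum-Detour-≤ Q⇒0≤ D)
    sum-Detour-≤ Q⇒0≤ (insert D)     =
      ℚP.≤-trans (ℚP.≤-reflexive (b-invisible _)) (sum-Detour-≤ Q⇒0≤ D)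
    sum-Detour-≤ Q⇒0≤ (replace {e} {es} {ps} Qe D) = begin
      x b ℚ.+ sumℚ (map x ps)            ≡⟨ cong (ℚ._+ sumℚ (map x ps)) x-b ⟩
      0ℚ ℚ.+ sumℚ (map x ps)             ≤⟨ ℚP.+-mono-≤ (Q⇒0≤ Qe) (sum-Detour-≤ Q⇒0≤ D) ⟩
      x (f e) ℚ.+ sumℚ (map (x ∘ f) es)  ∎
      where open ℚP.≤-Reasoning

  restrict : ∀ x → Face x → Polytopeₐ (x ∘ f)
  restrict x (x∈P , x-b) = record
    { bot≡0   = trans (cong x f-bot) (bot≡0 x∈P)
    ; top≡1   = trans (cong x f-top) (top≡1 x∈P)
    ; orderO  = orderOₐ
    ; nonnegC = λ e → nonnegC x∈P (f e)
    ; chainC  = chainCₐ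
    }
    where
    orderOₐ : ∀ h q → h ≺A q → isC (f h) ≡ false → isC (f q) ≡ false → x (f h) ℚ.≤ x (f q)
    orderOₐ h q h≺q h∈O q∈O with cover h≺q
    ... | inj₁ fh≺fq      = orderO x∈P (f h) (f q) fh≺fq h∈O q∈O
    ... | inj₂ (fh≺b , _) with () ← trans (sym (C-downward fh≺b b∈C)) h∈O

    chainCₐ : ∀ es a → All Cₐ es → isC (f a) ≡ false → Linked _≺A_ es a →
              sumℚ (map (x ∘ f) es) ℚ.≤ x (f a)
    chainCₐ es a es⊆C a∈O L =
      let ps , D , L′ = liftChain es a L in begin
      sumℚ (map (x ∘ f) es) ≡⟨ sym (sum-Insertion x x-b D) ⟩
      sumℚ (map x ps)       ≤⟨ chainC x∈P ps (f a) (All-Detour b∈C D es⊆C) a∈O L′ ⟩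
      x (f a)               ∎
      where open ℚP.≤-Reasoning

  extend : ∀ y → Polytopeₐ y → Σ (B → ℚ) (λ x → Face x × x ∘ f ≗ y)
  extend y y∈P = x , (x∈P , x-b) , x∘f≗y
    where
    x : B → ℚ
    x p = [ const 0ℚ , y ∘ proj₁ ]′ (split p)

    x∘f≗y : x ∘ f ≗ y
    x∘f≗y e with split (f e)
    ... | inj₁ fe≡b          = ⊥-elim (f≢b e fe≡b)
    ... | inj₂ (e′ , fe≡fe′) = cong y (sym (injective fe≡fe′))

    x-b : x b ≡ 0ℚ
    x-b with split b
    ... | inj₁ _          = refl
    ... | inj₂ (e , b≡fe) = ⊥-elim (f≢b e (sym b≡fe))

    b∉O : isC b ≡ false → ⊥
    b∉O b∈O with () ← trans (sym b∈C) b∈O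

    orderOₓ : ∀ p q → p ≺B q → isC p ≡ false → isC q ≡ false → x p ℚ.≤ x q
    orderOₓ p q p≺q p∈O q∈O with split p | split q
    ... | inj₁ refl       | _               = ⊥-elim (b∉O p∈O)
    ... | inj₂ _          | inj₁ refl       = ⊥-elim (b∉O q∈O)
    ... | inj₂ (h , refl) | inj₂ (h′ , refl) = orderO y∈P h h′ (reflect p≺q) p∈O q∈O

    nonnegCₓ : ∀ p → isC p ≡ true → 0ℚ ℚ.≤ x p
    nonnegCₓ p p∈C with split p
    ... | inj₁ refl       = ℚP.≤-refl
    ... | inj₂ (h , refl) = nonnegC y∈P h p∈C

    chainCₓ : ∀ ps a → All (λ p → isC p ≡ true) ps → isC a ≡ false → Linked _≺B_ ps a →
              sumℚ (map x ps) ℚ.≤ x a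
    chainCₓ ps a ps⊆C a∈O L with split a
    ... | inj₁ refl        = ⊥-elim (b∉O a∈O)
    ... | inj₂ (a′ , refl) =
      let es , D , L′ = lowerChain ps a′ L in begin
      sumℚ (map x ps)        ≤⟨ sum-Detour-≤ x x-b (λ {e} → nonnegCₓ (f e)) D ⟩
      sumℚ (map (x ∘ f) es)  ≡⟨ cong sumℚ (map-cong x∘f≗y es) ⟩
      sumℚ (map y es)        ≤⟨ chainC y∈P es a′ (All-Detour⁻ id D ps⊆C) a∈O L′ ⟩
      y a′                   ∎
      where open ℚP.≤-Reasoning

    x∈P : InChainOrderPolytope _≺B_ isC botB topB x
    x∈P = record
      { bot≡0   = trans (cong x (sym f-bot)) (trans (x∘f≗y botA) (bot≡0 y∈P))
      ; top≡1   = trans (cong x (sym f-top)) (trans (x∘f≗y topA) (top≡1 y∈P))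
      ; orderO  = orderOₓ
      ; nonnegC = nonnegCₓ
      ; chainC  = chainCₓ
      }

  restrict-injective : ∀ {x x′} → x b ≡ 0ℚ → x′ b ≡ 0ℚ → x ∘ f ≗ x′ ∘ f → x ≗ x′
  restrict-injective x-b x′-b x∘f≗x′∘f p with split p
  ... | inj₁ refl       = trans x-b (sym x′-b)
  ... | inj₂ (e , refl) = x∘f≗x′∘f e

liftℕ : (ℕ → ℕ) → ℕ → ℕ
liftℕ σ zero    = zero
liftℕ σ (suc n) = suc (σ n)

liftℕ-id : ∀ n → liftℕ id n ≡ n
liftℕ-id zero    = refl
liftℕ-id (suc n) = refl

-- punchInℕ r n = n if n < r, and suc n otherwise (cf. Data.Fin.punchIn).
punchInℕ : ℕ → ℕ → ℕ
punchInℕ zero    = suc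
punchInℕ (suc r) = liftℕ (punchInℕ r)

punchInℕ-cover : ∀ r m → suc (punchInℕ r m) ≡ punchInℕ r (suc m)
                       ⊎ (suc (punchInℕ r m) ≡ r × suc r ≡ punchInℕ r (suc m))
punchInℕ-cover zero          m       = inj₁ refl
punchInℕ-cover (suc zero)    zero    = inj₂ (refl , refl)
punchInℕ-cover (suc (suc r)) zero    = inj₁ refl
punchInℕ-cover (suc r)       (suc m) =
  Sum.map (cong suc) (Product.map (cong suc) (cong suc)) (punchInℕ-cover r m)

punchInℕ-reflect : ∀ r m n → suc (punchInℕ r m) ≡ punchInℕ r n → suc m ≡ n
punchInℕ-reflect zero          m       n             eq = suc-injective eq
punchInℕ-reflect (suc r)       zero    zero          ()
punchInℕ-reflect (suc zero)    zero    (suc n)       ()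
punchInℕ-reflect (suc (suc r)) zero    (suc zero)    eq = refl
punchInℕ-reflect (suc (suc r)) zero    (suc (suc n)) ()
punchInℕ-reflect (suc r)       (suc m) zero          ()
punchInℕ-reflect (suc r)       (suc m) (suc n)       eq =
  cong suc (punchInℕ-reflect r m n (suc-injective eq))

punchInℕ-bypass : ∀ r m n → suc (punchInℕ r m) ≡ r → suc r ≡ punchInℕ r n → suc m ≡ n
punchInℕ-bypass zero          m       n             ()
punchInℕ-bypass (suc zero)    zero    zero          _  ()
punchInℕ-bypass (suc zero)    zero    (suc zero)    _  _  = refl
punchInℕ-bypass (suc zero)    zero    (suc (suc n)) _  ()
punchInℕ-bypass (suc (suc r)) zero    n             ()
punchInℕ-bypass (suc r)       (suc m) zero          _  ()
punchInℕ-bypass (suc r)       (suc m) (suc n)       e₁ e₂ =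
  cong suc (punchInℕ-bypass r m n (suc-injective e₁) (suc-injective e₂))

isCₖ-downward : ∀ {τ k} {p q : Elem τ} → p ⋖ q → isCₖ k q ≡ true → isCₖ k p ≡ true
isCₖ-downward {k = k} {p} {q} p⋖q q∈C =
  Equivalence.to T-≡ (≤⇒≤ᵇ (≤-trans (n≤1+n (rank p))
    (subst (_≤ k) (sym p⋖q) (≤ᵇ⇒≤ (rank q) k (Equivalence.from T-≡ q∈C)))))

liftE : ∀ {t ts} → Elem ts → Elem (t ∷ ts)
liftE bot       = bot
liftE (mid a c) = mid (suc a) c
liftE top       = top

ι-zero : ∀ t ts i j (c : Fin t) → ι (t ∷ ts) (suc i) j (mid zero c) ≡ mid zero c
ι-zero (suc zero)    ts i j c = refl
ι-zero (suc (suc m)) ts i j c = refl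

ι-liftE : ∀ t ts i j e → ι (t ∷ ts) (suc i) j (liftE e) ≡ liftE (ι ts i j e)
ι-liftE t             ts i j bot       = refl
ι-liftE t             ts i j top       = refl
ι-liftE zero          ts i j (mid a c) = refl
ι-liftE (suc zero)    ts i j (mid a c) = refl
ι-liftE (suc (suc m)) ts i j (mid a c) = refl

ι-split : ∀ τ i j p → p ≡ mid i j ⊎ ∃[ e ] (p ≡ ι τ i j e)
ι-split τ i j bot = inj₂ (bot , refl)
ι-split τ i j top = inj₂ (top , refl)
ι-split (t ∷ ts) (suc i) j (mid zero c) = inj₂ (mid zero c , sym (ι-zero t ts i j c))
ι-split (t ∷ ts) (suc i) j (mid (suc a) c) with ι-split ts i j (mid a c)
... | inj₁ eq       = inj₁ (cong liftE eq)
... | inj₂ (e , eq) = inj₂ (liftE e , trans (cong liftE eq) (sym (ι-liftE t ts i j e)))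
ι-split (suc zero ∷ ts) zero zero (mid zero zero) = inj₁ refl
ι-split (suc zero ∷ ts) zero j (mid (suc a) c) = inj₂ (mid a c , refl)
ι-split (suc (suc m) ∷ ts) zero j (mid zero c) with j Fin.≟ c
... | yes refl = inj₁ refl
... | no j≢c    = inj₂ (mid zero (punchOut j≢c) , cong (mid zero) (sym (punchIn-punchOut j≢c)))
ι-split (suc (suc m) ∷ ts) zero j (mid (suc a) c) = inj₂ (mid (suc a) c , refl)

ι⁻¹ : ∀ τ i (j : Fin (lookup τ i)) → Elem τ → Maybe (Elem (shrink τ i))
ι⁻¹ τ i j bot = just bot
ι⁻¹ τ i j top = just top
ι⁻¹ (t ∷ ts) (suc i) j (mid zero c) = just (mid zero c)
ι⁻¹ (t ∷ ts) (suc i) j (mid (suc a) c) = Maybe.map liftE (ι⁻¹ ts i j (mid a c))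
ι⁻¹ (suc zero ∷ ts) zero j (mid zero c) = nothing
ι⁻¹ (suc zero ∷ ts) zero j (mid (suc a) c) = just (mid a c)
ι⁻¹ (suc (suc m) ∷ ts) zero j (mid zero c) with j Fin.≟ c
... | yes _   = nothing
... | no j≢c  = just (mid zero (punchOut j≢c))
ι⁻¹ (suc (suc m) ∷ ts) zero j (mid (suc a) c) = just (mid (suc a) c)

ι⁻¹-ι : ∀ τ i j e → ι⁻¹ τ i j (ι τ i j e) ≡ just e
ι⁻¹-ι τ i j bot = refl
ι⁻¹-ι τ i j top = refl
ι⁻¹-ι (t ∷ ts) (suc i) j (mid zero c) rewrite ι-zero t ts i j c = refl
ι⁻¹-ι (t ∷ ts) (suc i) j (mid (suc a) c) rewrite ι-liftE t ts i j (mid a c) =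
  cong (Maybe.map liftE) (ι⁻¹-ι ts i j (mid a c))
ι⁻¹-ι (suc zero ∷ ts) zero j (mid a c) = refl
ι⁻¹-ι (suc (suc m) ∷ ts) zero j (mid zero c) with j Fin.≟ punchIn j c
... | yes j≡ = contradiction (sym j≡) (punchInᵢ≢i j c)
... | no _   = cong (just ∘ mid zero) (trans (punchOut-cong j refl) (punchOut-punchIn j))
ι⁻¹-ι (suc (suc m) ∷ ts) zero j (mid (suc a) c) = refl

ι⁻¹-b : ∀ τ i j → ι⁻¹ τ i j (mid i j) ≡ nothing
ι⁻¹-b (t ∷ ts) (suc i) j = cong (Maybe.map liftE) (ι⁻¹-b ts i j)
ι⁻¹-b (suc zero ∷ ts) zero j = refl
ι⁻¹-b (suc (suc m) ∷ ts) zero j with j Fin.≟ j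
... | yes _  = refl
... | no j≢j = contradiction refl j≢j

ι-injective : ∀ τ i j → Injective _≡_ _≡_ (ι τ i j)
ι-injective τ i j {e} {e′} ιe≡ιe′ = just-injective (begin
  just e                 ≡⟨ sym (ι⁻¹-ι τ i j e) ⟩
  ι⁻¹ τ i j (ι τ i j e)  ≡⟨ cong (ι⁻¹ τ i j) ιe≡ιe′ ⟩
  ι⁻¹ τ i j (ι τ i j e′) ≡⟨ ι⁻¹-ι τ i j e′ ⟩
  just e′                ∎)
  where open ≡-Reasoning

ι≢b : ∀ τ i j e → ι τ i j e ≢ mid i j
ι≢b τ i j e ιe≡b
  with () ← trans (sym (ι⁻¹-ι τ i j e)) (trans (cong (ι⁻¹ τ i j) ιe≡b) (ι⁻¹-b τ i j))

data RankShape (τ : List ℕ) (i : Fin (length τ)) (j : Fin (lookup τ i)) : Set where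
  rank-deleted : (∀ e → rank (ι τ i j e) ≡ punchInℕ (suc (toℕ i)) (rank e)) → RankShape τ i j
  rank-kept    : (∀ e → rank (ι τ i j e) ≡ rank e) →
                 ∀ a (c : Fin (lookup (shrink τ i) a)) → toℕ a ≡ toℕ i → RankShape τ i j

ι-rank-lift : ∀ t ts i j {σ} → (∀ e → rank (ι ts i j e) ≡ σ (rank e)) →
              ∀ e → rank (ι (t ∷ ts) (suc i) j e) ≡ liftℕ σ (rank e)
ι-rank-lift t ts i j ranks bot             = refl
ι-rank-lift t ts i j ranks (mid zero c)    =
  trans (cong rank (ι-zero t ts i j c)) (cong suc (ranks bot))
ι-rank-lift t ts i j ranks (mid (suc a) c) =
  trans (cong rank (ι-liftE t ts i j (mid a c))) (cong suc (ranks (mid a c)))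
ι-rank-lift t ts i j ranks top             = cong suc (ranks top)

rankShape : ∀ τ i j → RankShape τ i j
rankShape (suc zero ∷ ts) zero j =
  rank-deleted λ { bot → refl ; (mid a c) → refl ; top → refl }
rankShape (suc (suc m) ∷ ts) zero j = rank-kept
  (λ { bot → refl ; (mid zero c) → refl ; (mid (suc a) c) → refl ; top → refl })
  zero zero refl
rankShape (t ∷ ts) (suc i) j with rankShape ts i j
... | rank-deleted ranks = rank-deleted (ι-rank-lift t ts i j ranks)
... | rank-kept ranks a c a≡i = rank-kept
  (λ e → trans (ι-rank-lift t ts i j ranks e) (liftℕ-id (rank e))) (suc a) c (cong suc a≡i)

module _ (τ : List ℕ) (i : Fin (length τ)) (j : Fin (lookup τ i)) where

  ι-cover : ∀ {h q} → h ⋖ q →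
            ι τ i j h ⋖ ι τ i j q ⊎ (ι τ i j h ⋖ mid i j × mid i j ⋖ ι τ i j q)
  ι-cover {h} {q} h⋖q with rankShape τ i j
  ... | rank-deleted ranks rewrite ranks h | ranks q | sym h⋖q =
    punchInℕ-cover (suc (toℕ i)) (rank h)
  ... | rank-kept ranks _ _ _ rewrite ranks h | ranks q = inj₁ h⋖q

  ι-reflect : ∀ {h q} → ι τ i j h ⋖ ι τ i j q → h ⋖ q
  ι-reflect {h} {q} ιh⋖ιq with rankShape τ i j
  ... | rank-deleted ranks rewrite ranks h | ranks q =
    punchInℕ-reflect (suc (toℕ i)) (rank h) (rank q) ιh⋖ιq
  ... | rank-kept ranks _ _ _ rewrite ranks h | ranks q = ιh⋖ιq

  ι-bypass : ∀ k → isCₖ k (mid {τ} i j) ≡ true →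
             ∀ {h q} → ι τ i j h ⋖ mid i j → mid i j ⋖ ι τ i j q →
             h ⋖ q ⊎ ∃[ b′ ] (isCₖ k (ι τ i j b′) ≡ true × h ⋖ b′ × b′ ⋖ q)
  ι-bypass k b∈C {h} {q} ιh⋖b b⋖ιq with rankShape τ i j
  ... | rank-deleted ranks rewrite ranks h | ranks q =
    inj₁ (punchInℕ-bypass (suc (toℕ i)) (rank h) (rank q) ιh⋖b b⋖ιq)
  ... | rank-kept ranks a c a≡i rewrite ranks h | ranks q =
    inj₂ (mid a c , trans (cong (λ r → r ≤ᵇ k) (trans (ranks (mid a c)) (cong suc a≡i))) b∈C
                  , trans ιh⋖b (cong suc (sym a≡i)) , trans (cong suc (cong suc a≡i)) b⋖ιq)

  ι-isDeletion : ∀ k → isCₖ k (mid {τ} i j) ≡ true →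
                 IsDeletion (_⋖_ {shrink τ i}) (_⋖_ {τ}) (isCₖ k) (ι τ i j) (mid i j)
  ι-isDeletion k b∈C = record
    { injective  = ι-injective τ i j
    ; f≢b        = ι≢b τ i j
    ; split      = ι-split τ i j
    ; b∈C        = b∈C
    ; C-downward = isCₖ-downward
    ; cover      = ι-cover
    ; reflect    = ι-reflect
    ; bypass     = ι-bypass k b∈C
    }

proposition3p6 :
  (τ : List ℕ) → All (λ t → 0 < t) τ →
  (k : ℕ) → k ≤ length τ →
  (i : Fin (length τ)) (j : Fin (lookup τ i)) →
  isCₖ k (mid {τ} i j) ≡ true →
  let b = mid {τ} i j
      τ̃ = shrink τ i
      π = λ (x : Elem τ → ℚ) (e : Elem τ̃) → x (ι τ i j e)
      InF = λ (x : Elem τ → ℚ) → InOτ τ k x × x b ≡ 0ℚ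
      InÕ = InChainOrderPolytope (_⋖_ {τ̃}) (λ e → isCₖ k (ι τ i j e)) bot top
  in ((x : Elem τ → ℚ) → InF x → InÕ (π x))
     × ((y : Elem τ̃ → ℚ) → InÕ y → Σ (Elem τ → ℚ) (λ x → InF x × π x ≗ y))
     × ((x x′ : Elem τ → ℚ) → InF x → InF x′ → π x ≗ π x′ → x ≗ x′)
proposition3p6 τ _ k _ i j b∈C =
  restrict , extend , λ _ _ (_ , x-b) (_ , x′-b) → restrict-injective x-b x′-b
  where open Deletion (ι-isDeletion τ i j k b∈C) refl refl
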